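{- Let $G$ be a graph with two vertices $u$ and $v$ connected by a unique path $P$, such that every inner vertex of $P$ either has degree $2$ in $G$, or has a single leg attached (and degree $3$). Let $V(P^+)$ be the set of inner vertices of $P$ together with all vertices belonging to a leg attached to an inner vertex of $P$. Then for every detection pair $(W,L)$ of $G$, the pair $(W\setminus V(P^+),\,(L\setminus V(P^+))\cup\{u,v\})$ is a detection pair of $G$.
   Context: All graphs are finite, simple and undirected, and $d(\cdot,\cdot)$ denotes the distance. A vertex $w$ dominates the vertices of $N[w]$; a vertex $l$ separates $x,y$ if $d(x,l)\neq d(y,l)$. Given $W,L\subseteq V(G)$, a vertex $x$ is distinguished by $(W,L)$ if either $x$ is dominated by a vertex of $W$, or for every other vertex $y$, either $y$ is dominated by a vertex of $W$ or some vertex of $L$ separates $x$ and $y$; $(W,L)$ is a detection pair if every vertex is distinguished. A vertex $z$ of degree at least $3$ is a special branching point if there is a path from $z$ to a vertex of degree $1$ whose inner vertices all have degree $2$; for each such path $Q$, $Q-z$ is a leg attached to $z$. -}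

module Defs where

open import Data.Nat using (ℕ; zero; suc; _<_; _≥_)
open import Data.Fin using (Fin)
open import Data.Bool using (Bool; true; false)
open import Data.List using (List; []; _∷_; length; filterᵇ; allFin)
open import Data.List.Membership.Propositional using (_∈_)
open import Data.List.Relation.Unary.Unique.Propositional using (Unique)
open import Data.Product using (Σ; ∃; _×_; _,_)
open import Data.Sum using (_⊎_)
open import Relation.Nullary using (¬_)
open import Relation.Binary.PropositionalEquality using (_≡_; _≢_)

record Graph (n : ℕ) : Set where
  field
    adj    : Fin n → Fin n → Bool
    sym    : ∀ x y → adj x y ≡ adj y x
    irrefl : ∀ x → adj x x ≡ false
open Graph public

module _ {n : ℕ} (G : Graph n) where

  Edge : Fin n → Fin n → Set
  Edge x y = adj G x y ≡ true

  deg : Fin n → ℕ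
  deg x = length (filterᵇ (adj G x) (allFin n))

  data Walk : Fin n → Fin n → ℕ → Set where
    here : ∀ x → Walk x x zero
    step : ∀ {x y z k} → Edge x y → Walk y z k → Walk x z (suc k)

  -- d(x,y) = k  (the distance may be undefined = infinite if disconnected)
  Dist : Fin n → Fin n → ℕ → Set
  Dist x y k = Walk x y k × (∀ m → m < k → ¬ Walk x y m)

  -- d(x,l) = d(y,l)  (both equal to the same k, or both infinite)
  SameDist : Fin n → Fin n → Fin n → Set
  SameDist x y l = ∀ k → (Dist x l k → Dist y l k) × (Dist y l k → Dist x l k)

  Separates : Fin n → Fin n → Fin n → Set
  Separates l x y = ¬ SameDist x y l

  data WalkL : Fin n → Fin n → List (Fin n) → Set where
    single : ∀ u → WalkL u u (u ∷ [])
    cons   : ∀ {u w v ps} → Edge u w → WalkL w v (w ∷ ps) → WalkL u v (u ∷ w ∷ ps)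

  IsPath : Fin n → Fin n → List (Fin n) → Set
  IsPath u v P = WalkL u v P × Unique P

  UniquePath : Fin n → Fin n → List (Fin n) → Set
  UniquePath u v P = IsPath u v P × (∀ Q → IsPath u v Q → Q ≡ P)

  Inner : List (Fin n) → Fin n → Fin n → Fin n → Set
  Inner P u v x = x ∈ P × x ≢ u × x ≢ v

  -- Q is a path from a special branching point z to a degree-1 vertex
  -- whose inner vertices all have degree 2; the leg is Q - z.
  LegPath : Fin n → List (Fin n) → Set
  LegPath z Q = deg z ≥ 3 × (∃ λ e → IsPath z e Q × deg e ≡ 1
                   × (∀ x → Inner Q z e x → deg x ≡ 2))

  InLeg : Fin n → List (Fin n) → Fin n → Set
  InLeg z Q x = x ∈ Q × x ≢ z

  SingleLeg : Fin n → Set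
  SingleLeg z = ∃ λ Q → LegPath z Q × (∀ Q′ → LegPath z Q′ → Q′ ≡ Q)

  VPplus : List (Fin n) → Fin n → Fin n → Fin n → Set
  VPplus P u v x = Inner P u v x
                 ⊎ (∃ λ z → ∃ λ Q → Inner P u v z × LegPath z Q × InLeg z Q x)

  Dominated : (Fin n → Set) → Fin n → Set
  Dominated W x = ∃ λ w → W w × (w ≡ x ⊎ Edge w x)

  Distinguished : (Fin n → Set) → (Fin n → Set) → Fin n → Set
  Distinguished W L x =
    Dominated W x
    ⊎ (∀ y → y ≢ x → Dominated W y ⊎ (∃ λ l → L l × Separates l x y))

  DetectionPair : (Fin n → Set) → (Fin n → Set) → Set
  DetectionPair W L = ∀ x → Distinguished W L x

module Submission where

-- Write P = p₀ p₁ … pₘ with p₀ = u and pₘ = v. Erasing the loops of any u–v walk leaves a u–v path,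
-- which must be P, so every u–v walk contains P as a subsequence; hence for every vertex x,
-- d(x, pᵢ) = max (d(x,u) − i, d(x,v) − (m − i)). A leg z q₁ … q_r can only be entered through z,
-- so d(x, q_s) = d(x, z) + s for x off the leg. Consequently, if d(x,u) = d(y,u) and
-- d(x,v) = d(y,v), then no vertex of V(P⁺) separates x and y, and the degree conditions force
-- x = y as soon as one of them lies in or next to V(P⁺). So whatever a vertex of V(P⁺)
-- dominates or separates in (W, L) is separated by u or v instead.

open import Defs hiding (sym)
open import Data.Bool using (true; T; T?)
open import Data.Unit using (tt)
open import Data.Bool.Properties using () renaming (_≟_ to _≟ᵇ_)
open import Data.Empty using (⊥; ⊥-elim)
open import Data.Fin using (Fin)
open import Data.Fin.Properties using (nonZeroIndex) renaming (_≟_ to _≟ᶠ_; any? to anyᶠ?)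
open import Data.List using (List; []; _∷_; length; _++_; allFin; filterᵇ)
open import Data.List.Properties using (length-++; length-tabulate)
open import Data.List.Membership.Propositional using (_∈_; lose)
open import Data.List.Membership.Propositional.Properties
  using (∈-++⁻; ∈-++⁺ˡ; ∈-++⁺ʳ; ∈-∃++; ∈-allFin; ∈-filter⁺)
open import Data.List.Relation.Unary.Any using (here; there; any?; satisfied)
open import Data.List.Relation.Unary.All using (All; []; _∷_; lookup)
open import Data.List.Relation.Unary.All.Properties using (All¬⇒¬Any; ¬Any⇒All¬)
open import Data.List.Relation.Unary.AllPairs using ([]; _∷_)
open import Data.List.Relation.Unary.Unique.Propositional using (Unique)
open import Data.List.Relation.Binary.Sublist.Propositional
  using (_⊆_; []; _∷_; _∷ʳ_; ⊆-refl; ⊆-trans)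
open import Data.List.Relation.Binary.Sublist.Propositional.Properties using (All-resp-⊆)
open import Data.List.Relation.Binary.Sublist.Heterogeneous.Properties using (length-mono-≤)
open import Data.Nat
open import Data.Nat.Properties
open import Data.Product using (∃; ∃₂; _×_; _,_; proj₁; proj₂)
open import Data.Sum using (_⊎_; inj₁; inj₂)
open import Function using (case_of_; _∘_)
open import Relation.Nullary using (¬_; Dec; yes; no)
open import Relation.Nullary.Decidable using (_×-dec_)
open import Relation.Binary.PropositionalEquality

module _ {A : Set} where

  infix 4 _[_]=_

  data _[_]=_ : List A → ℕ → A → Set where
    here  : ∀ {x xs} → x ∷ xs [ 0 ]= x
    there : ∀ {x y xs i} → xs [ i ]= y → x ∷ xs [ suc i ]= y

  []=⇒∈ : ∀ {xs i x} → xs [ i ]= x → x ∈ xs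
  []=⇒∈ here      = here refl
  []=⇒∈ (there p) = there ([]=⇒∈ p)

  ∈⇒[]= : ∀ {xs x} → x ∈ xs → ∃ λ i → xs [ i ]= x
  ∈⇒[]= (here refl) = 0 , here
  ∈⇒[]= (there x∈xs) with ∈⇒[]= x∈xs
  ... | i , p = suc i , there p

  []=-functional : ∀ {xs i x y} → xs [ i ]= x → xs [ i ]= y → x ≡ y
  []=-functional here      here      = refl
  []=-functional (there p) (there q) = []=-functional p q

  []=⇒<length : ∀ {xs i x} → xs [ i ]= x → i < length xs
  []=⇒<length here      = s≤s z≤n
  []=⇒<length (there p) = s≤s ([]=⇒<length p)

  <length⇒[]= : ∀ xs {i} → i < length xs → ∃ λ x → xs [ i ]= x
  <length⇒[]= (x ∷ xs) {zero}  _       = x , here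
  <length⇒[]= (x ∷ xs) {suc i} (s≤s i<) with <length⇒[]= xs i<
  ... | y , p = y , there p

  []=-injective : ∀ {xs i j x} → Unique xs → xs [ i ]= x → xs [ j ]= x → i ≡ j
  []=-injective _          here      here      = refl
  []=-injective (x∉ ∷ _)   here      (there q) = ⊥-elim (All¬⇒¬Any x∉ ([]=⇒∈ q))
  []=-injective (x∉ ∷ _)   (there p) here      = ⊥-elim (All¬⇒¬Any x∉ ([]=⇒∈ p))
  []=-injective (_ ∷ uxs)  (there p) (there q) = cong suc ([]=-injective uxs p q)

  []=-++⁺ˡ : ∀ {xs ys i x} → xs [ i ]= x → xs ++ ys [ i ]= x
  []=-++⁺ˡ here      = here
  []=-++⁺ˡ (there p) = there ([]=-++⁺ˡ p)

  Unique-resp-⊇ : ∀ {xs ys : List A} → xs ⊆ ys → Unique ys → Unique xs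
  Unique-resp-⊇ []          []          = []
  Unique-resp-⊇ (_ ∷ʳ xs⊆)  (_ ∷ uys)   = Unique-resp-⊇ xs⊆ uys
  Unique-resp-⊇ (refl ∷ xs⊆) (y∉ ∷ uys) = All-resp-⊆ xs⊆ y∉ ∷ Unique-resp-⊇ xs⊆ uys

  ⊆-[]= : ∀ {xs ys : List A} {i x} → xs ⊆ ys → xs [ i ]= x →
          ∃ λ j → ys [ j ]= x × i ≤ j × length xs ∸ suc i ≤ length ys ∸ suc j
  ⊆-[]= (_ ∷ʳ xs⊆) p with ⊆-[]= xs⊆ p
  ... | j , q , i≤j , rest = suc j , there q , m≤n⇒m≤1+n i≤j , rest
  ⊆-[]= (refl ∷ xs⊆) here = 0 , here , z≤n , length-mono-≤ xs⊆
  ⊆-[]= (refl ∷ xs⊆) (there p) with ⊆-[]= xs⊆ p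
  ... | j , q , i≤j , rest = suc j , there q , s≤s i≤j , rest

  Unique⇒length≤ : ∀ {xs ys : List A} → Unique xs → (∀ {a} → a ∈ xs → a ∈ ys) →
                   length xs ≤ length ys
  Unique⇒length≤ {[]}     _          _   = z≤n
  Unique⇒length≤ {x ∷ xs} (x∉ ∷ uxs) xs⊆ with ∈-∃++ (xs⊆ (here refl))
  ... | pre , post , refl = begin
      suc (length xs)                 ≤⟨ s≤s (Unique⇒length≤ uxs xs⊆pre++post) ⟩
      suc (length (pre ++ post))      ≡⟨ cong suc (length-++ pre) ⟩
      suc (length pre + length post)  ≡⟨ +-suc (length pre) (length post) ⟨
      length pre + length (x ∷ post)  ≡⟨ length-++ pre ⟨
      length (pre ++ x ∷ post)        ∎
    where
    open ≤-Reasoning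
    xs⊆pre++post : ∀ {a} → a ∈ xs → a ∈ pre ++ post
    xs⊆pre++post a∈ with ∈-++⁻ pre (xs⊆ (there a∈))
    ... | inj₁ a∈pre          = ∈-++⁺ˡ a∈pre
    ... | inj₂ (here refl)    = ⊥-elim (All¬⇒¬Any x∉ a∈)
    ... | inj₂ (there a∈post) = ∈-++⁺ʳ pre a∈post

∸-bound-swap : ∀ {d e b} → d ≤ b → e ≤ b ∸ d → d ≤ b ∸ e
∸-bound-swap {d} {e} {b} d≤b e≤b∸d =
  m+n≤o⇒m≤o∸n d (subst (_≤ b) (+-comm e d) (m≤o∸n⇒m+n≤o e d≤b e≤b∸d))

pred-∸ : ∀ k i → pred k ∸ i ≡ k ∸ suc i
pred-∸ zero    i = 0∸n≡0 i
pred-∸ (suc k) i = refl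

<-pred⇒suc< : ∀ {i k} → i < k → i ≢ pred k → suc i < k
<-pred⇒suc< {k = suc k} (s≤s i≤k) i≢k = s≤s (≤∧≢⇒< i≤k i≢k)

bounded-least : (P : ℕ → Set) → (∀ k → Dec (P k)) → ∀ B →
                (∃ λ k → k < B × P k × (∀ m → m < k → ¬ P m)) ⊎ (∀ k → k < B → ¬ P k)
bounded-least P P? zero = inj₂ λ _ ()
bounded-least P P? (suc B) with bounded-least P P? B
... | inj₁ (k , k<B , Pk , least) = inj₁ (k , m<n⇒m<1+n k<B , Pk , least)
... | inj₂ none with P? B
...   | yes PB = inj₁ (B , ≤-refl , PB , none)
...   | no ¬PB = inj₂ λ k k<1+B → case k <? B of λ where
          (yes k<B) → none k k<B
          (no k≮B)  → subst (λ j → ¬ P j) (≤-antisym (≮⇒≥ k≮B) (≤-pred k<1+B)) ¬PB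

module Walks {n : ℕ} (G : Graph n) where

  Edge-sym : ∀ {x y} → Edge G x y → Edge G y x
  Edge-sym {x} {y} e = trans (Graph.sym G y x) e

  Edge-irrefl : ∀ {x} → ¬ Edge G x x
  Edge-irrefl {x} e with trans (sym (irrefl G x)) e
  ... | ()

  walk-++ : ∀ {x y z k l} → Walk G x y k → Walk G y z l → Walk G x z (k + l)
  walk-++ (here _)   w′ = w′
  walk-++ (step e w) w′ = step e (walk-++ w w′)

  edge⇒walk : ∀ {x y} → Edge G x y → Walk G x y 1
  edge⇒walk {y = y} e = step e (here y)

  walk⇒edge : ∀ {x y} → Walk G x y 1 → Edge G x y
  walk⇒edge (step e (here _)) = e

  walk₀⇒≡ : ∀ {x y} → Walk G x y 0 → x ≡ y
  walk₀⇒≡ (here _) = refl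

  walk-reverse : ∀ {x y k} → Walk G x y k → Walk G y x k
  walk-reverse (here x) = here x
  walk-reverse (step {k = k} e w) =
    subst (Walk G _ _) (+-comm k 1) (walk-++ (walk-reverse w) (edge⇒walk (Edge-sym e)))

  walkL-cons : ∀ {x y z ω} → Edge G x y → WalkL G y z ω → WalkL G x z (x ∷ ω)
  walkL-cons e w@(single _) = cons e w
  walkL-cons e w@(cons _ _) = cons e w

  walkL-head : ∀ {x y ω} → WalkL G x y ω → ω [ 0 ]= x
  walkL-head (single _) = here
  walkL-head (cons _ _) = here

  walkL-last : ∀ {x y ω} → WalkL G x y ω → ω [ pred (length ω) ]= y
  walkL-last (single _) = here
  walkL-last (cons _ w) = there (walkL-last w)

  walkL⇒walk : ∀ {x y ω} → WalkL G x y ω → Walk G x y (pred (length ω))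
  walkL⇒walk (single x) = here x
  walkL⇒walk (cons e w) = step e (walkL⇒walk w)

  walk⇒walkL : ∀ {x y k} → Walk G x y k → ∃ λ ω → WalkL G x y (x ∷ ω) × length ω ≡ k
  walk⇒walkL (here x) = [] , single x , refl
  walk⇒walkL (step e w) with walk⇒walkL w
  ... | ω , wL , refl = _ ∷ ω , walkL-cons e wL , refl

  walkL-++ : ∀ {x y z ω ω′} → WalkL G x y ω → WalkL G y z (y ∷ ω′) → WalkL G x z (ω ++ ω′)
  walkL-++ (single _) w′ = w′
  walkL-++ (cons e w) w′ = cons e (walkL-++ w w′)

  walkL-prefix : ∀ {x y ω j b} → WalkL G x y ω → ω [ j ]= b → Walk G x b j
  walkL-prefix (single _) here      = here _
  walkL-prefix (cons _ _) here      = here _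
  walkL-prefix (cons e w) (there p) = step e (walkL-prefix w p)

  walkL-segment : ∀ {x y ω i j a b} → WalkL G x y ω → ω [ i ]= a → ω [ j ]= b → i ≤ j →
                  Walk G a b (j ∸ i)
  walkL-segment (single x) here      q         _         = walkL-prefix (single x) q
  walkL-segment (cons e w) here      q         _         = walkL-prefix (cons e w) q
  walkL-segment (cons _ w) (there p) (there q) (s≤s i≤j) = walkL-segment w p q i≤j

  walkL-step : ∀ {x y ω i a b} → WalkL G x y ω → ω [ i ]= a → ω [ suc i ]= b → Edge G a b
  walkL-step {i = i} w p q =
    walk⇒edge (subst (Walk G _ _) (m+n∸n≡m 1 i) (walkL-segment w p q (n≤1+n i)))

  walkL-suffix : ∀ {x y ω a} → WalkL G x y ω → a ∈ ω →
                 ∃ λ ω′ → WalkL G a y (a ∷ ω′) × a ∷ ω′ ⊆ ω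
  walkL-suffix (single x) (here refl) = _ , single x , ⊆-refl
  walkL-suffix (cons e w) (here refl) = _ , cons e w , ⊆-refl
  walkL-suffix (cons _ w) (there a∈)  with walkL-suffix w a∈
  ... | ω′ , w′ , ⊆ω = ω′ , w′ , _ ∷ʳ ⊆ω

  -- Loop erasure: cut the walk at the next occurrence of its first vertex, if any.
  walkL-erase : ∀ {x y ω} → WalkL G x y ω → ∃ λ π → WalkL G x y π × Unique π × π ⊆ ω
  walkL-erase (single x) = _ , single x , [] ∷ [] , ⊆-refl
  walkL-erase {x} (cons e w) with walkL-erase w
  ... | π , wπ , uπ , π⊆ with any? (x ≟ᶠ_) π
  ...   | yes x∈π = let ω′ , w′ , ⊆π = walkL-suffix wπ x∈π in
                    _ , w′ , Unique-resp-⊇ ⊆π uπ , x ∷ʳ ⊆-trans ⊆π π⊆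
  ...   | no x∉π = _ , walkL-cons e wπ , ¬Any⇒All¬ π x∉π ∷ uπ , refl ∷ π⊆

  Unique⇒length≤n : {π : List (Fin n)} → Unique π → length π ≤ n
  Unique⇒length≤n {π} uπ =
    subst (length π ≤_) (length-tabulate (λ x → x)) (Unique⇒length≤ uπ (λ {a} _ → ∈-allFin a))

  walk⇒short-walk : ∀ {x y k} → Walk G x y k → ∃ λ k′ → k′ < n × Walk G x y k′
  walk⇒short-walk w with walk⇒walkL w
  ... | ω , wL , _ with walkL-erase wL
  ... | π , wπ , uπ , _ =
    pred (length π) , ≤-trans ([]=⇒<length (walkL-last wπ)) (Unique⇒length≤n uπ) , walkL⇒walk wπ

  walk? : ∀ x y k → Dec (Walk G x y k)
  walk? x y zero with x ≟ᶠ y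
  ... | yes refl = yes (here x)
  ... | no x≢y   = no λ w → x≢y (walk₀⇒≡ w)
  walk? x y (suc k) with anyᶠ? (λ w → adj G x w ≟ᵇ true ×-dec walk? w y k)
  ... | yes (w , e , r) = yes (step e r)
  ... | no none         = no λ { (step e r) → none (_ , e , r) }

-- Distances are computed by bounded search; unreachable pairs get the junk value n.
module Distance {n : ℕ} (G : Graph n) where

  open Walks G

  private
    dist-spec : ∀ x y → (∃ λ k → k < n × Walk G x y k × (∀ m → m < k → ¬ Walk G x y m))
                        ⊎ (∀ k → ¬ Walk G x y k)
    dist-spec x y with bounded-least (Walk G x y) (walk? x y) n
    ... | inj₁ found = inj₁ found
    ... | inj₂ none  = inj₂ λ k w → let k′ , k′<n , w′ = walk⇒short-walk w in none k′ k′<n w′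

  dist : Fin n → Fin n → ℕ
  dist x y with dist-spec x y
  ... | inj₁ (k , _) = k
  ... | inj₂ _       = n

  dist-≤ : ∀ {x y k} → Walk G x y k → dist x y ≤ k
  dist-≤ {x} {y} {k} w with dist-spec x y
  ... | inj₁ (_ , _ , _ , least) = ≮⇒≥ λ k<d → least k k<d w
  ... | inj₂ none                = ⊥-elim (none k w)

  walk⇒dist<n : ∀ {x y k} → Walk G x y k → dist x y < n
  walk⇒dist<n {x} {y} {k} w with dist-spec x y
  ... | inj₁ (_ , k<n , _) = k<n
  ... | inj₂ none          = ⊥-elim (none k w)

  dist-walk : ∀ {x y} → dist x y < n → Walk G x y (dist x y)
  dist-walk {x} {y} d<n with dist-spec x y
  ... | inj₁ (_ , _ , w , _) = w
  ... | inj₂ _               = ⊥-elim (<-irrefl refl d<n)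

  dist≤n : ∀ x y → dist x y ≤ n
  dist≤n x y with dist-spec x y
  ... | inj₁ (_ , k<n , _) = <⇒≤ k<n
  ... | inj₂ _             = ≤-refl

  dist≮n⇒dist≡n : ∀ {x y} → ¬ dist x y < n → dist x y ≡ n
  dist≮n⇒dist≡n {x} {y} d≮n = ≤-antisym (dist≤n x y) (≮⇒≥ d≮n)

  dist-refl : ∀ x → dist x x ≡ 0
  dist-refl x = n≤0⇒n≡0 (dist-≤ (here x))

  dist-sym : ∀ x y → dist x y ≡ dist y x
  dist-sym x y with dist x y <? n | dist y x <? n
  ... | yes x↝y | yes y↝x = ≤-antisym (dist-≤ (walk-reverse (dist-walk y↝x)))
                                      (dist-≤ (walk-reverse (dist-walk x↝y)))
  ... | yes x↝y | no y↛x  = ⊥-elim (y↛x (walk⇒dist<n (walk-reverse (dist-walk x↝y))))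
  ... | no x↛y  | yes y↝x = ⊥-elim (x↛y (walk⇒dist<n (walk-reverse (dist-walk y↝x))))
  ... | no x↛y  | no y↛x  = trans (dist≮n⇒dist≡n x↛y) (sym (dist≮n⇒dist≡n y↛x))

  dist-triangle : ∀ x y z → dist x z ≤ dist x y + dist y z
  dist-triangle x y z with dist x y <? n | dist y z <? n
  ... | yes x↝y | yes y↝z = dist-≤ (walk-++ (dist-walk x↝y) (dist-walk y↝z))
  ... | no x↛y  | _       =
    ≤-trans (dist≤n x z) (subst (λ d → n ≤ d + dist y z) (sym (dist≮n⇒dist≡n x↛y)) (m≤m+n n _))
  ... | yes _   | no y↛z  =
    ≤-trans (dist≤n x z) (subst (λ d → n ≤ dist x y + d) (sym (dist≮n⇒dist≡n y↛z)) (m≤n+m n _))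

  dist≡0⇒≡ : ∀ {x y} → dist x y ≡ 0 → x ≡ y
  dist≡0⇒≡ {x} {y} d≡0 =
    walk₀⇒≡ (subst (Walk G x y) d≡0 (dist-walk (subst (_< n) (sym d≡0) 0<n)))
    where
    0<n : 0 < n
    0<n = >-nonZero⁻¹ n {{nonZeroIndex x}}

  Edge⇒dist≡1 : ∀ {x y} → Edge G x y → dist x y ≡ 1
  Edge⇒dist≡1 {x} {y} e with dist x y in d≡ | dist-≤ (edge⇒walk e)
  ... | 0           | _       = ⊥-elim (Edge-irrefl (subst (Edge G x) (sym (dist≡0⇒≡ d≡)) e))
  ... | 1           | _       = refl
  ... | suc (suc _) | s≤s ()

  dist-first-step : ∀ {x y t} → dist x y ≡ suc t → dist x y < n →
                    ∃ λ w → Edge G x w × dist w y ≡ t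
  dist-first-step {x} {y} {t} d≡ d<n with subst (Walk G x y) d≡ (dist-walk d<n)
  ... | step {y = w} e w↝y = w , e , ≤-antisym (dist-≤ w↝y) t≤dist
    where
    t≤dist : t ≤ dist w y
    t≤dist = ≤-pred (begin
      suc t              ≡⟨ d≡ ⟨
      dist x y           ≤⟨ dist-triangle x w y ⟩
      dist x w + dist w y ≡⟨ cong (_+ dist w y) (Edge⇒dist≡1 e) ⟩
      suc (dist w y)     ∎)
      where open ≤-Reasoning

  dist≡1⇒Edge : ∀ {x y} → dist x y ≡ 1 → dist x y < n → Edge G x y
  dist≡1⇒Edge {x} {y} d≡1 d<n = walk⇒edge (subst (Walk G x y) d≡1 (dist-walk d<n))

  dist<n-extend : ∀ {x y z k} → dist x y < n → Walk G y z k → dist x z < n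
  dist<n-extend x↝y w = walk⇒dist<n (walk-++ (dist-walk x↝y) w)

  Dist⇒dist≡ : ∀ {x y k} → Dist G x y k → dist x y ≡ k
  Dist⇒dist≡ (w , least) =
    ≤-antisym (dist-≤ w) (≮⇒≥ λ d<k → least _ d<k (dist-walk (walk⇒dist<n w)))

  dist⇒Dist : ∀ {x y} → dist x y < n → Dist G x y (dist x y)
  dist⇒Dist d<n = dist-walk d<n , λ m m<d w → <⇒≱ m<d (dist-≤ w)

  dist≡⇒SameDist : ∀ {x y l} → dist x l ≡ dist y l → SameDist G x y l
  dist≡⇒SameDist {l = l} x≡y k = transfer x≡y , transfer (sym x≡y)
    where
    transfer : ∀ {a b} → dist a l ≡ dist b l → Dist G a l k → Dist G b l k
    transfer {b = b} a≡b D = subst (Dist G b l) (trans (sym a≡b) (Dist⇒dist≡ D))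
                                   (dist⇒Dist (subst (_< n) a≡b (walk⇒dist<n (proj₁ D))))

  dist≢⇒Separates : ∀ {x y l} → dist x l ≢ dist y l → Separates G l x y
  dist≢⇒Separates {x} {y} {l} x≢y same with dist x l <? n | dist y l <? n
  ... | yes x↝l | _       = x≢y (sym (Dist⇒dist≡ (proj₁ (same _) (dist⇒Dist x↝l))))
  ... | no _    | yes y↝l = x≢y (Dist⇒dist≡ (proj₂ (same _) (dist⇒Dist y↝l)))
  ... | no x↛l  | no y↛l  = x≢y (trans (dist≮n⇒dist≡n x↛l) (sym (dist≮n⇒dist≡n y↛l)))

module Degrees {n : ℕ} (G : Graph n) where

  Edge⇒∈-neighbours : ∀ {x y} → Edge G x y → y ∈ filterᵇ (adj G x) (allFin n)
  Edge⇒∈-neighbours {x} {y} e = ∈-filter⁺ (λ w → T? (adj G x w)) (∈-allFin y) (subst T (sym e) tt)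

  neighbour-∈-of-deg≡length : ∀ {x y} (ys : List (Fin n)) → Unique ys → All (Edge G x) ys →
                              deg G x ≡ length ys → Edge G x y → y ∈ ys
  neighbour-∈-of-deg≡length {x} {y} ys uys ys-adj deg≡ e with any? (y ≟ᶠ_) ys
  ... | yes y∈ys = y∈ys
  ... | no y∉ys  =
    ⊥-elim (<-irrefl (sym deg≡) (Unique⇒length≤ (¬Any⇒All¬ ys y∉ys ∷ uys) adjacent))
    where
    adjacent : ∀ {w} → w ∈ y ∷ ys → w ∈ filterᵇ (adj G x) (allFin n)
    adjacent (here refl) = Edge⇒∈-neighbours e
    adjacent (there w∈) = Edge⇒∈-neighbours (lookup ys-adj w∈)

module PathDistance {n : ℕ} (G : Graph n) (u v : Fin n) (P : List (Fin n))
                    (P-unique : UniquePath G u v P) where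

  open Walks G
  open Distance G

  P-walk : WalkL G u v P
  P-walk = proj₁ (proj₁ P-unique)

  m : ℕ
  m = pred (length P)

  P[0]=u : P [ 0 ]= u
  P[0]=u = walkL-head P-walk

  P[m]=v : P [ m ]= v
  P[m]=v = walkL-last P-walk

  index≤m : ∀ {i p} → P [ i ]= p → i ≤ m
  index≤m p = pred-mono-≤ ([]=⇒<length p)

  P⊆walk : ∀ {ω} → WalkL G u v ω → P ⊆ ω
  P⊆walk w with walkL-erase w
  ... | π , wπ , uπ , π⊆ω = subst (_⊆ _) (proj₂ P-unique π (wπ , uπ)) π⊆ω

  dist-u-≤ : ∀ {i p} → P [ i ]= p → dist u p ≤ i
  dist-u-≤ p = dist-≤ (walkL-prefix P-walk p)

  dist-v-≤ : ∀ {i p} → P [ i ]= p → dist p v ≤ m ∸ i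
  dist-v-≤ p = dist-≤ (walkL-segment P-walk p P[m]=v (index≤m p))

  -- On the u–v walk through x, p lies either between u and x or between x and v.
  private
    dist-to-path-≤ : ∀ {x i p A B} → WalkL G u x (u ∷ A) → WalkL G x v (x ∷ B) → P [ i ]= p →
                     dist x p ≤ (length A ∸ i) ⊔ (length B ∸ (m ∸ i))
    dist-to-path-≤ {x} {i} {p} {A} {B} wA wB Pi = by-position (⊆-[]= (P⊆walk wω) Pi)
      where
      a = length A
      b = length B
      wω : WalkL G u v (u ∷ A ++ B)
      wω = walkL-++ wA wB
      ω[a]=x : u ∷ A ++ B [ a ]= x
      ω[a]=x = []=-++⁺ˡ (walkL-last wA)
      by-position : (∃ λ J → u ∷ A ++ B [ J ]= p × i ≤ J × length P ∸ suc i ≤ length (A ++ B) ∸ J) →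
                    dist x p ≤ (a ∸ i) ⊔ (b ∸ (m ∸ i))
      by-position (J , ω[J]=p , i≤J , after) with J ≤? a
      ... | yes J≤a = ≤-trans (begin
            dist x p ≡⟨ dist-sym x p ⟩
            dist p x ≤⟨ dist-≤ (walkL-segment wω ω[J]=p ω[a]=x J≤a) ⟩
            a ∸ J    ≤⟨ ∸-monoʳ-≤ a i≤J ⟩
            a ∸ i    ∎) (m≤m⊔n _ _)
        where open ≤-Reasoning
      ... | no J≰a = ≤-trans (≤-trans (dist-≤ (walkL-segment wω ω[a]=x ω[J]=p a≤J))
                                      (∸-bound-swap J∸a≤b m∸i≤b∸[J∸a]))
                             (m≤n⊔m _ _)
        where
        open ≤-Reasoning
        a≤J : a ≤ J
        a≤J = <⇒≤ (≰⇒> J≰a)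
        J∸a≤b : J ∸ a ≤ b
        J∸a≤b = m≤n+o⇒m∸n≤o J a (≤-trans (≤-pred ([]=⇒<length ω[J]=p)) (≤-reflexive (length-++ A)))
        m∸i≤b∸[J∸a] : m ∸ i ≤ b ∸ (J ∸ a)
        m∸i≤b∸[J∸a] = begin
          m ∸ i                  ≡⟨ pred-∸ (length P) i ⟩
          length P ∸ suc i       ≤⟨ after ⟩
          length (A ++ B) ∸ J    ≡⟨ cong₂ _∸_ (length-++ A) (sym (m+[n∸m]≡n a≤J)) ⟩
          (a + b) ∸ (a + (J ∸ a)) ≡⟨ [m+n]∸[m+o]≡n∸o a b (J ∸ a) ⟩
          b ∸ (J ∸ a)            ∎

  dist-to-path : ∀ {x i p} → dist x u < n → P [ i ]= p →
                 dist x p ≡ (dist x u ∸ i) ⊔ (dist x v ∸ (m ∸ i))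
  dist-to-path {x} {i} {p} x↝u Pi = ≤-antisym upper (⊔-lub lower-u lower-v)
    where
    open ≤-Reasoning
    walk-xu = dist-walk x↝u
    walk-xv = dist-walk (walk⇒dist<n (walk-++ walk-xu (walkL⇒walk P-walk)))
    upper : dist x p ≤ (dist x u ∸ i) ⊔ (dist x v ∸ (m ∸ i))
    upper with walk⇒walkL (walk-reverse walk-xu) | walk⇒walkL walk-xv
    ... | A , wA , |A| | B , wB , |B| =
      subst (λ d → dist x p ≤ d) (cong₂ (λ a b → (a ∸ i) ⊔ (b ∸ (m ∸ i))) |A| |B|)
            (dist-to-path-≤ wA wB Pi)
    lower-u : dist x u ∸ i ≤ dist x p
    lower-u = m≤n+o⇒m∸n≤o (dist x u) i (begin
      dist x u            ≤⟨ dist-triangle x p u ⟩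
      dist x p + dist p u ≡⟨ cong (dist x p +_) (dist-sym p u) ⟩
      dist x p + dist u p ≤⟨ +-monoʳ-≤ (dist x p) (dist-u-≤ Pi) ⟩
      dist x p + i        ≡⟨ +-comm (dist x p) i ⟩
      i + dist x p        ∎)
    lower-v : dist x v ∸ (m ∸ i) ≤ dist x p
    lower-v = m≤n+o⇒m∸n≤o (dist x v) (m ∸ i) (begin
      dist x v              ≤⟨ dist-triangle x p v ⟩
      dist x p + dist p v   ≤⟨ +-monoʳ-≤ (dist x p) (dist-v-≤ Pi) ⟩
      dist x p + (m ∸ i)    ≡⟨ +-comm (dist x p) (m ∸ i) ⟩
      (m ∸ i) + dist x p    ∎)

module Decidability {n : ℕ} (G : Graph n) where

  Inner? : ∀ P u v w → Dec (Inner G P u v w)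
  Inner? P u v w with any? (w ≟ᶠ_) P | w ≟ᶠ u | w ≟ᶠ v
  ... | yes w∈P | no w≢u | no w≢v = yes (w∈P , w≢u , w≢v)
  ... | no w∉P  | _      | _      = no λ (w∈P , _) → w∉P w∈P
  ... | yes _   | yes w≡u | _     = no λ (_ , w≢u , _) → w≢u w≡u
  ... | yes _   | no _   | yes w≡v = no λ (_ , _ , w≢v) → w≢v w≡v

  InLeg? : ∀ z Q w → Dec (InLeg G z Q w)
  InLeg? z Q w with any? (w ≟ᶠ_) Q | w ≟ᶠ z
  ... | yes w∈Q | yes w≡z = no λ (_ , w≢z) → w≢z w≡z
  ... | yes w∈Q | no w≢z  = yes (w∈Q , w≢z)
  ... | no w∉Q  | _       = no λ (w∈Q , _) → w∉Q w∈Q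

module LegDistance {n : ℕ} (G : Graph n) (z : Fin n) (Q : List (Fin n)) (leg : LegPath G z Q) where

  open Walks G
  open Distance G
  open Degrees G
  open Decidability G

  end : Fin n
  end = proj₁ (proj₂ leg)

  Q-walk : WalkL G z end Q
  Q-walk = proj₁ (proj₁ (proj₂ (proj₂ leg)))

  Q-unique : Unique Q
  Q-unique = proj₂ (proj₁ (proj₂ (proj₂ leg)))

  deg-end : deg G end ≡ 1
  deg-end = proj₁ (proj₂ (proj₂ (proj₂ leg)))

  deg-inner : ∀ w → Inner G Q z end w → deg G w ≡ 2
  deg-inner = proj₂ (proj₂ (proj₂ (proj₂ leg)))

  Q[0]=z : Q [ 0 ]= z
  Q[0]=z = walkL-head Q-walk

  index⇒InLeg : ∀ {t w} → Q [ suc t ]= w → InLeg G z Q w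
  index⇒InLeg Qw = []=⇒∈ Qw , λ { refl → 0≢1+n ([]=-injective Q-unique Q[0]=z Qw) }

  InLeg⇒index : ∀ {w} → InLeg G z Q w → ∃ λ t → Q [ suc t ]= w
  InLeg⇒index (w∈Q , w≢z) with ∈⇒[]= w∈Q
  ... | zero  , Qw = ⊥-elim (w≢z ([]=-functional Qw Q[0]=z))
  ... | suc t , Qw = t , Qw

  ¬InLeg⇒index≡0 : ∀ {t w} → Q [ t ]= w → ¬ InLeg G z Q w → t ≡ 0
  ¬InLeg⇒index≡0 {zero}  _  _    = refl
  ¬InLeg⇒index≡0 {suc _} Qw ¬leg = ⊥-elim (¬leg (index⇒InLeg Qw))

  leg-neighbour : ∀ {t w y} → Q [ suc t ]= w → Edge G w y → Q [ t ]= y ⊎ Q [ suc (suc t) ]= y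
  leg-neighbour {t} {w} {y} Qw w~y with <length⇒[]= Q (<⇒≤ ([]=⇒<length Qw)) | suc t ≟ pred (length Q)
  ... | q₋ , Qq₋ | yes at-end with neighbour-∈-of-deg≡length (q₋ ∷ []) ([] ∷ [])
                                     (Edge-sym (walkL-step Q-walk Qq₋ Qw) ∷ []) deg-w≡1 w~y
    where
    deg-w≡1 : deg G w ≡ 1
    deg-w≡1 = subst (λ x → deg G x ≡ 1)
                    ([]=-functional (walkL-last Q-walk) (subst (Q [_]= w) at-end Qw)) deg-end
  ...   | here refl = inj₁ Qq₋
  leg-neighbour {t} {w} {y} Qw w~y | q₋ , Qq₋ | no not-end
    with <length⇒[]= Q (<-pred⇒suc< ([]=⇒<length Qw) not-end)
  ... | q₊ , Qq₊ with neighbour-∈-of-deg≡length (q₋ ∷ q₊ ∷ []) ((q₋≢q₊ ∷ []) ∷ [] ∷ [])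
                        (Edge-sym (walkL-step Q-walk Qq₋ Qw) ∷ walkL-step Q-walk Qw Qq₊ ∷ []) deg-w≡2 w~y
    where
    q₋≢q₊ : q₋ ≢ q₊
    q₋≢q₊ refl = <⇒≢ (m<n⇒m<1+n (n<1+n t)) ([]=-injective Q-unique Qq₋ Qq₊)
    w≢end : w ≢ end
    w≢end refl = not-end ([]=-injective Q-unique Qw (walkL-last Q-walk))
    deg-w≡2 : deg G w ≡ 2
    deg-w≡2 = let w∈Q , w≢z = index⇒InLeg Qw in deg-inner w (w∈Q , w≢z , w≢end)
  ...   | here refl         = inj₁ Qq₋
  ...   | there (here refl) = inj₂ Qq₊

  leg-index-step : ∀ {t t′ w w′} → Q [ t ]= w → Q [ t′ ]= w′ → Edge G w w′ → t′ ≤ suc t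
  leg-index-step {t′ = zero} _ _ _ = z≤n
  leg-index-step {t′ = suc t′} Qw Qw′ w~w′ with leg-neighbour Qw′ (Edge-sym w~w′)
  ... | inj₁ Qw₋ = ≤-reflexive (cong suc ([]=-injective Q-unique Qw₋ Qw))
  ... | inj₂ Qw₊ = ≤-trans (m≤n+m (suc t′) 2) (≤-reflexive (cong suc ([]=-injective Q-unique Qw₊ Qw)))

  ¬InLeg-neighbour : ∀ {t w w′} → ¬ InLeg G z Q w → Q [ suc t ]= w′ → Edge G w w′ → t ≡ 0 × w ≡ z
  ¬InLeg-neighbour ¬leg Qw′ w~w′ with leg-neighbour Qw′ (Edge-sym w~w′)
  ... | inj₂ Qw = ⊥-elim (¬leg (index⇒InLeg Qw))
  ... | inj₁ Qw with ¬InLeg⇒index≡0 Qw ¬leg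
  ...   | refl = refl , []=-functional Qw Q[0]=z

  -- The two bounds are proved together because a walk may leave and re-enter the leg.
  walk-to-leg : ∀ {s q w k} → Q [ s ]= q → Walk G w q k →
                (¬ InLeg G z Q w → dist w z + s ≤ k) × (∀ {t} → Q [ t ]= w → s ≤ t + k)
  walk-to-leg {zero} Qq (here q) with []=-functional Qq Q[0]=z
  ... | refl = (λ _ → ≤-reflexive (cong (_+ 0) (dist-refl z))) , λ _ → z≤n
  walk-to-leg {suc s} Qq (here _) =
    (λ ¬leg → ⊥-elim (¬leg (index⇒InLeg Qq))) ,
    λ Qt → ≤-reflexive (trans ([]=-injective Q-unique Qq Qt) (sym (+-identityʳ _)))
  walk-to-leg {s} {q} {w} {suc k} Qq (step {y = w′} w~w′ rest) with walk-to-leg Qq rest | InLeg? z Q w′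
  ... | via-root , _ | no ¬leg′ = outside , inside
    where
    open ≤-Reasoning
    outside : ¬ InLeg G z Q w → dist w z + s ≤ suc k
    outside _ = begin
      dist w z + s              ≤⟨ +-monoˡ-≤ s (dist-triangle w w′ z) ⟩
      dist w w′ + dist w′ z + s ≡⟨ cong (λ d → d + dist w′ z + s) (Edge⇒dist≡1 w~w′) ⟩
      suc (dist w′ z + s)       ≤⟨ s≤s (via-root ¬leg′) ⟩
      suc k                     ∎
    inside : ∀ {t} → Q [ t ]= w → s ≤ t + suc k
    inside {t} _ = begin
      s              ≤⟨ m≤n+m s (dist w′ z) ⟩
      dist w′ z + s  ≤⟨ via-root ¬leg′ ⟩
      k              ≤⟨ n≤1+n k ⟩
      suc k          ≤⟨ m≤n+m (suc k) t ⟩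
      t + suc k      ∎
  ... | _ , by-index | yes leg′ with InLeg⇒index leg′
  ...   | t′ , Qw′ = outside , inside
    where
    open ≤-Reasoning
    outside : ¬ InLeg G z Q w → dist w z + s ≤ suc k
    outside ¬leg with ¬InLeg-neighbour ¬leg Qw′ w~w′
    ... | refl , refl = subst (_≤ suc k) (cong (_+ s) (sym (dist-refl z))) (by-index Qw′)
    inside : ∀ {t} → Q [ t ]= w → s ≤ t + suc k
    inside {t} Qw = begin
      s              ≤⟨ by-index Qw′ ⟩
      suc t′ + k     ≤⟨ +-monoˡ-≤ k (leg-index-step Qw Qw′ w~w′) ⟩
      suc t + k      ≡⟨ +-suc t k ⟨
      t + suc k      ∎

  dist-via-root : ∀ {x s q} → ¬ InLeg G z Q x → Q [ s ]= q → dist x z < n → dist x q ≡ dist x z + s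
  dist-via-root ¬leg Qq x↝z =
    ≤-antisym (dist-≤ walk-xq) (proj₁ (walk-to-leg Qq (dist-walk (walk⇒dist<n walk-xq))) ¬leg)
    where
    walk-xq = walk-++ (dist-walk x↝z) (walkL-prefix Q-walk Qq)

  dist-from-root : ∀ {s q} → Q [ s ]= q → dist z q ≡ s
  dist-from-root Qq =
    trans (dist-via-root (λ (_ , z≢z) → z≢z refl) Qq (walk⇒dist<n (here z))) (cong (_+ _) (dist-refl z))

  dist-within-leg : ∀ {i j a b} → Q [ i ]= a → Q [ j ]= b → dist a b ≤ i ⊔ j
  dist-within-leg {i} {j} {a} {b} Qa Qb with i ≤? j
  ... | yes i≤j = ≤-trans (dist-≤ (walkL-segment Q-walk Qa Qb i≤j)) (≤-trans (m∸n≤m j i) (m≤n⊔m i j))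
  ... | no i≰j  = begin
    dist a b ≡⟨ dist-sym a b ⟩
    dist b a ≤⟨ dist-≤ (walkL-segment Q-walk Qb Qa (<⇒≤ (≰⇒> i≰j))) ⟩
    i ∸ j    ≤⟨ m∸n≤m i j ⟩
    i        ≤⟨ m≤m⊔n i j ⟩
    i ⊔ j    ∎
    where open ≤-Reasoning

  leg-separates : ∀ {x y a t k} → ¬ InLeg G z Q x → dist x z ≡ suc t → dist x z < n →
                  Q [ suc t ]= y → Q [ suc k ]= a → dist x a ≢ dist y a
  leg-separates {x} {y} {a} {t} {k} ¬leg dxz≡ x↝z Qy Qa dxa≡dya = <-irrefl refl (begin-strict
    suc t + suc k    ≡⟨ cong (_+ suc k) dxz≡ ⟨
    dist x z + suc k ≡⟨ dist-via-root ¬leg Qa x↝z ⟨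
    dist x a         ≡⟨ dxa≡dya ⟩
    dist y a         ≤⟨ dist-within-leg Qy Qa ⟩
    suc t ⊔ suc k    <⟨ s≤s (≤-trans (s≤s (m⊔n≤m+n t k)) (≤-reflexive (sym (+-suc t k)))) ⟩
    suc t + suc k    ∎)
    where open ≤-Reasoning

module EndDistances {n : ℕ} (G : Graph n) (u v : Fin n) (P : List (Fin n))
                (P-unique : UniquePath G u v P)
                (inner-deg : ∀ x → Inner G P u v x → deg G x ≡ 2 ⊎ (deg G x ≡ 3 × SingleLeg G x)) where

  open Walks G
  open Distance G
  open Degrees G
  open Decidability G
  open PathDistance G u v P P-unique

  SameEndDists : Fin n → Fin n → Set
  SameEndDists x y = dist x u ≡ dist y u × dist x v ≡ dist y v

  SameEndDists-sym : ∀ {x y} → SameEndDists x y → SameEndDists y x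
  SameEndDists-sym (≡u , ≡v) = sym ≡u , sym ≡v

  ends-separate : ∀ {x y} → ¬ SameEndDists x y → Separates G u x y ⊎ Separates G v x y
  ends-separate {x} {y} ¬same with dist x u ≟ dist y u | dist x v ≟ dist y v
  ... | no ≢u  | _      = inj₁ (dist≢⇒Separates ≢u)
  ... | yes _  | no ≢v  = inj₂ (dist≢⇒Separates ≢v)
  ... | yes ≡u | yes ≡v = ⊥-elim (¬same (≡u , ≡v))

  same-dist-on-path : ∀ {x y p} → SameEndDists x y → dist y u < n → p ∈ P → dist x p ≡ dist y p
  same-dist-on-path {x} {y} {p} (≡u , ≡v) y↝u p∈P with ∈⇒[]= p∈P
  ... | i , Pp = begin
    dist x p                              ≡⟨ dist-to-path (subst (_< n) (sym ≡u) y↝u) Pp ⟩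
    (dist x u ∸ i) ⊔ (dist x v ∸ (m ∸ i)) ≡⟨ cong₂ (λ a b → (a ∸ i) ⊔ (b ∸ (m ∸ i))) ≡u ≡v ⟩
    (dist y u ∸ i) ⊔ (dist y v ∸ (m ∸ i)) ≡⟨ dist-to-path y↝u Pp ⟨
    dist y p                              ∎
    where open ≡-Reasoning

  path-vertex-determined : ∀ {x y} → y ∈ P → SameEndDists x y → dist y u < n → x ≡ y
  path-vertex-determined y∈P same y↝u = dist≡0⇒≡ (trans (same-dist-on-path same y↝u y∈P) (dist-refl _))

  inner-neighbours : ∀ {z} → Inner G P u v z →
                     ∃₂ λ p₋ p₊ → p₋ ∈ P × p₊ ∈ P × Edge G z p₋ × Edge G z p₊ × p₋ ≢ p₊
  inner-neighbours {z} (z∈P , z≢u , z≢v) with ∈⇒[]= z∈P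
  ... | zero  , Pz = ⊥-elim (z≢u ([]=-functional Pz P[0]=u))
  ... | suc j , Pz with <length⇒[]= P (<⇒≤ ([]=⇒<length Pz))
                      | <length⇒[]= P (<-pred⇒suc< ([]=⇒<length Pz) not-last)
    where
    not-last : suc j ≢ m
    not-last j+1≡m = z≢v ([]=-functional (subst (P [_]= z) j+1≡m Pz) P[m]=v)
  ...   | p₋ , Pp₋ | p₊ , Pp₊ =
    p₋ , p₊ , []=⇒∈ Pp₋ , []=⇒∈ Pp₊ ,
    Edge-sym (walkL-step P-walk Pp₋ Pz) , walkL-step P-walk Pz Pp₊ ,
    λ { refl → <⇒≢ (m<n⇒m<1+n (n<1+n j)) ([]=-injective (proj₂ (proj₁ P-unique)) Pp₋ Pp₊) }

  private
    reach-transfer : ∀ {x y} → SameEndDists x y → dist y u < n → dist x u < n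
    reach-transfer (≡u , _) = subst (_< n) (sym ≡u)

    twin-on-path : ∀ {x y} → x ∈ P → SameEndDists x y → dist y u < n → y ∈ P
    twin-on-path x∈P same y↝u =
      subst (_∈ P) (sym (path-vertex-determined x∈P (SameEndDists-sym same) (reach-transfer same y↝u))) x∈P

  off-path-neighbour-determined : ∀ {x y z} → Inner G P u v z → deg G z ≡ 3 → Edge G z y → ¬ y ∈ P →
                                  SameEndDists x y → dist y u < n → x ≡ y
  off-path-neighbour-determined {x} {y} {z} z-inner deg≡3 z~y y∉P same y↝u
    with inner-neighbours z-inner
  ... | p₋ , p₊ , p₋∈P , p₊∈P , z~p₋ , z~p₊ , p₋≢p₊
    with neighbour-∈-of-deg≡length (p₋ ∷ p₊ ∷ y ∷ []) distinct (z~p₋ ∷ z~p₊ ∷ z~y ∷ []) deg≡3 z~x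
    where
    off-path : ∀ {p} → p ∈ P → p ≢ y
    off-path p∈P refl = y∉P p∈P
    distinct : Unique (p₋ ∷ p₊ ∷ y ∷ [])
    distinct = (p₋≢p₊ ∷ off-path p₋∈P ∷ []) ∷ (off-path p₊∈P ∷ []) ∷ [] ∷ []
    dzx≡dzy : dist z x ≡ dist z y
    dzx≡dzy = begin
      dist z x ≡⟨ dist-sym z x ⟩
      dist x z ≡⟨ same-dist-on-path same y↝u (proj₁ z-inner) ⟩
      dist y z ≡⟨ dist-sym y z ⟩
      dist z y ∎
      where open ≡-Reasoning
    z~x : Edge G z x
    z~x = dist≡1⇒Edge (trans dzx≡dzy (Edge⇒dist≡1 z~y))
                      (subst (_< n) (sym dzx≡dzy) (walk⇒dist<n (edge⇒walk z~y)))
  ... | here refl               = ⊥-elim (y∉P (twin-on-path p₋∈P same y↝u))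
  ... | there (here refl)       = ⊥-elim (y∉P (twin-on-path p₊∈P same y↝u))
  ... | there (there (here x≡y)) = x≡y

  leg-root-deg≡3 : ∀ {z Q} → Inner G P u v z → LegPath G z Q → deg G z ≡ 3
  leg-root-deg≡3 {z} z-inner leg with inner-deg z z-inner
  ... | inj₁ deg≡2       = ⊥-elim (≤⇒≯ (subst (3 ≤_) deg≡2 (proj₁ leg)) (n<1+n 2))
  ... | inj₂ (deg≡3 , _) = deg≡3

  module _ {z Q} (z-inner : Inner G P u v z) (leg : LegPath G z Q) where

    open LegDistance G z Q leg

    private
      z∈P : z ∈ P
      z∈P = proj₁ z-inner

      dist-to-root : ∀ {x y t} → Q [ suc t ]= y → SameEndDists x y → dist y u < n → dist x z ≡ suc t
      dist-to-root {x} {y} Qy same y↝u =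
        trans (same-dist-on-path same y↝u z∈P) (trans (dist-sym y z) (dist-from-root Qy))

    module _ {x y t} (¬x-leg : ¬ InLeg G z Q x) (Qy : Q [ suc t ]= y)
             (same : SameEndDists x y) (y↝u : dist y u < n) where

      private
        dxz≡ : dist x z ≡ suc t
        dxz≡ = dist-to-root Qy same y↝u

        x↝z : dist x z < n
        x↝z = subst (_< n) (sym (same-dist-on-path same y↝u z∈P))
                    (walk⇒dist<n (walk-reverse (walkL-prefix Q-walk Qy)))

        neighbour-far : ∀ {w} → Edge G z w → w ∈ P ⊎ InLeg G z Q w → t < dist w x
        neighbour-far {w} z~w w∈P⊎leg with InLeg? z Q w | w∈P⊎leg
        ... | yes w-leg | _ = let k , Qw = InLeg⇒index w-leg in begin-strict
          t                ≤⟨ m≤m+n t (suc k) ⟩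
          t + suc k        <⟨ n<1+n _ ⟩
          suc t + suc k    ≡⟨ cong (_+ suc k) dxz≡ ⟨
          dist x z + suc k ≡⟨ dist-via-root ¬x-leg Qw x↝z ⟨
          dist x w         ≡⟨ dist-sym x w ⟩
          dist w x         ∎
          where open ≤-Reasoning
        ... | no ¬w-leg | inj₁ w∈P = begin-strict
          t                <⟨ m<n+m t z<s ⟩
          2 + t            ≡⟨ cong (_+ suc t) (Edge⇒dist≡1 (Edge-sym z~w)) ⟨
          dist w z + suc t ≡⟨ dist-via-root ¬w-leg Qy (walk⇒dist<n (edge⇒walk (Edge-sym z~w))) ⟨
          dist w y         ≡⟨ dist-sym w y ⟩
          dist y w         ≡⟨ same-dist-on-path same y↝u w∈P ⟨
          dist x w         ≡⟨ dist-sym x w ⟩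
          dist w x         ∎
          where open ≤-Reasoning
        ... | no ¬w-leg | inj₂ w-leg = ⊥-elim (¬w-leg w-leg)

      -- A shortest x–z walk would enter z from a neighbour at distance t from x.
      outside-leg-absurd : ⊥
      outside-leg-absurd
        with inner-neighbours z-inner | <length⇒[]= Q {1} (≤-trans (s≤s (s≤s z≤n)) ([]=⇒<length Qy))
      ... | p₋ , p₊ , p₋∈P , p₊∈P , z~p₋ , z~p₊ , p₋≢p₊ | q₁ , Qq₁
        with dist-first-step (trans (dist-sym z x) dxz≡) (subst (_< n) (dist-sym x z) x↝z)
      ... | w , z~w , dwx≡t
        with neighbour-∈-of-deg≡length (p₋ ∷ p₊ ∷ q₁ ∷ []) distinct (z~p₋ ∷ z~p₊ ∷ z~q₁ ∷ [])
                                       (leg-root-deg≡3 z-inner leg) z~w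
        where
        z~q₁ : Edge G z q₁
        z~q₁ = walkL-step Q-walk Q[0]=z Qq₁
        q₁-off-path : ∀ {p} → p ∈ P → p ≢ q₁
        q₁-off-path p∈P refl = leg-separates ¬x-leg dxz≡ x↝z Qy Qq₁ (same-dist-on-path same y↝u p∈P)
        distinct : Unique (p₋ ∷ p₊ ∷ q₁ ∷ [])
        distinct = (p₋≢p₊ ∷ q₁-off-path p₋∈P ∷ []) ∷ (q₁-off-path p₊∈P ∷ []) ∷ [] ∷ []
      ... | here refl                 = <⇒≢ (neighbour-far z~w (inj₁ p₋∈P)) (sym dwx≡t)
      ... | there (here refl)         = <⇒≢ (neighbour-far z~w (inj₁ p₊∈P)) (sym dwx≡t)
      ... | there (there (here refl)) = <⇒≢ (neighbour-far z~w (inj₂ (index⇒InLeg Qq₁))) (sym dwx≡t)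

    leg-vertex-determined : ∀ {x y t} → Q [ suc t ]= y → SameEndDists x y → dist y u < n → x ≡ y
    leg-vertex-determined {x} {y} {t} Qy same y↝u with InLeg? z Q x
    ... | no ¬x-leg = ⊥-elim (outside-leg-absurd ¬x-leg Qy same y↝u)
    ... | yes x-leg with InLeg⇒index x-leg
    ...   | i , Qx = []=-functional (subst (Q [_]= x) same-index Qx) Qy
      where
      same-index : suc i ≡ suc t
      same-index = trans (sym (dist-from-root Qx)) (trans (dist-sym z x) (dist-to-root Qy same y↝u))

    leg-or-root-determined : ∀ {x y s} → Q [ s ]= y → SameEndDists x y → dist y u < n → x ≡ y
    leg-or-root-determined {s = zero}  Qy =
      path-vertex-determined (subst (_∈ P) ([]=-functional Q[0]=z Qy) z∈P)
    leg-or-root-determined {s = suc _} Qy = leg-vertex-determined Qy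

  VPplus⇒reachable : ∀ {l} → VPplus G P u v l → ∃ λ k → Walk G u l k
  VPplus⇒reachable (inj₁ (l∈P , _)) = let i , Pl = ∈⇒[]= l∈P in i , walkL-prefix P-walk Pl
  VPplus⇒reachable (inj₂ (z , Q , (z∈P , _) , leg , (l∈Q , _))) =
    let i , Pz = ∈⇒[]= z∈P
        s , Ql = ∈⇒[]= l∈Q
    in i + s , walk-++ (walkL-prefix P-walk Pz) (walkL-prefix (LegDistance.Q-walk G z Q leg) Ql)

  dominated-by-VPplus-reachable : ∀ {y w} → VPplus G P u v w → w ≡ y ⊎ Edge G w y → dist y u < n
  dominated-by-VPplus-reachable w∈P⁺ (inj₁ refl) = walk⇒dist<n (walk-reverse (proj₂ (VPplus⇒reachable w∈P⁺)))
  dominated-by-VPplus-reachable w∈P⁺ (inj₂ w~y)  =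
    walk⇒dist<n (walk-reverse (walk-++ (proj₂ (VPplus⇒reachable w∈P⁺)) (edge⇒walk w~y)))

  private
    dominated-determined : ∀ {x y w} → VPplus G P u v w → w ≡ y ⊎ Edge G w y →
                           SameEndDists x y → dist y u < n → x ≡ y
    dominated-determined (inj₁ w-inner) (inj₁ refl) same y↝u = path-vertex-determined (proj₁ w-inner) same y↝u
    dominated-determined {y = y} {w} (inj₁ w-inner) (inj₂ w~y) same y↝u
      with any? (y ≟ᶠ_) P | inner-deg w w-inner
    ... | yes y∈P | _                = path-vertex-determined y∈P same y↝u
    ... | no y∉P  | inj₂ (deg≡3 , _) = off-path-neighbour-determined w-inner deg≡3 w~y y∉P same y↝u
    ... | no y∉P  | inj₁ deg≡2 with inner-neighbours w-inner
    ...   | p₋ , p₊ , p₋∈P , p₊∈P , w~p₋ , w~p₊ , p₋≢p₊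
      with neighbour-∈-of-deg≡length (p₋ ∷ p₊ ∷ []) ((p₋≢p₊ ∷ []) ∷ [] ∷ []) (w~p₋ ∷ w~p₊ ∷ []) deg≡2 w~y
    ...     | here refl         = ⊥-elim (y∉P p₋∈P)
    ...     | there (here refl) = ⊥-elim (y∉P p₊∈P)
    dominated-determined (inj₂ (z , Q , z-inner , leg , w-leg)) w-dom-y same y↝u
      with LegDistance.InLeg⇒index G z Q leg w-leg
    ... | s , Qw with w-dom-y
    ...   | inj₁ refl = leg-or-root-determined z-inner leg Qw same y↝u
    ...   | inj₂ w~y with LegDistance.leg-neighbour G z Q leg Qw w~y
    ...     | inj₁ Qy = leg-or-root-determined z-inner leg Qy same y↝u
    ...     | inj₂ Qy = leg-or-root-determined z-inner leg Qy same y↝u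

  dominated-by-VPplus-determined : ∀ {x y w} → VPplus G P u v w → w ≡ y ⊎ Edge G w y →
                                   SameEndDists x y → x ≡ y
  dominated-by-VPplus-determined w∈P⁺ w-dom-y same =
    dominated-determined w∈P⁺ w-dom-y same (dominated-by-VPplus-reachable w∈P⁺ w-dom-y)

  VPplus-same-dist : ∀ {x y l} → x ≢ y → SameEndDists x y → VPplus G P u v l → dist x l ≡ dist y l
  VPplus-same-dist {x} {y} {l} x≢y same l∈P⁺ with dist y u <? n
  ... | no y↛u = trans (dist≮n⇒dist≡n (unreachable x↛u)) (sym (dist≮n⇒dist≡n (unreachable y↛u)))
    where
    unreachable : ∀ {a} → ¬ dist a u < n → ¬ dist a l < n
    unreachable a↛u a↝l = a↛u (dist<n-extend a↝l (walk-reverse (proj₂ (VPplus⇒reachable l∈P⁺))))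
    x↛u : ¬ dist x u < n
    x↛u x↝u = y↛u (reach-transfer (SameEndDists-sym same) x↝u)
  ... | yes y↝u with l∈P⁺
  ...   | inj₁ (l∈P , _) = same-dist-on-path same y↝u l∈P
  ...   | inj₂ (z , Q , z-inner , leg , l-leg) with InLeg? z Q x | InLeg? z Q y
  ...     | yes x-leg | _ =
    ⊥-elim (x≢y (sym (leg-vertex-determined z-inner leg (proj₂ (InLeg⇒index x-leg))
                                             (SameEndDists-sym same) (reach-transfer same y↝u))))
    where open LegDistance G z Q leg
  ...     | no _ | yes y-leg =
    ⊥-elim (x≢y (leg-vertex-determined z-inner leg (proj₂ (InLeg⇒index y-leg)) same y↝u))
    where open LegDistance G z Q leg
  ...     | no ¬x-leg | no ¬y-leg = begin
    dist x l         ≡⟨ dist-via-root ¬x-leg Ql (reach-to-z (reach-transfer same y↝u)) ⟩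
    dist x z + s     ≡⟨ cong (_+ s) (same-dist-on-path same y↝u (proj₁ z-inner)) ⟩
    dist y z + s     ≡⟨ dist-via-root ¬y-leg Ql (reach-to-z y↝u) ⟨
    dist y l         ∎
    where
    open ≡-Reasoning
    open LegDistance G z Q leg
    s = proj₁ (∈⇒[]= (proj₁ l-leg))
    Ql = proj₂ (∈⇒[]= (proj₁ l-leg))
    reach-to-z : ∀ {a} → dist a u < n → dist a z < n
    reach-to-z a↝u = dist<n-extend a↝u (walkL-prefix P-walk (proj₂ (∈⇒[]= (proj₁ z-inner))))

  private
    InLegOf : Fin n → Fin n → Set
    InLegOf w z = ∃ λ Q → Inner G P u v z × LegPath G z Q × InLeg G z Q w

    InLegOf? : ∀ w z → Dec (InLegOf w z)
    InLegOf? w z with Inner? P u v z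
    ... | no ¬z-inner = no λ (_ , z-inner , _) → ¬z-inner z-inner
    ... | yes z-inner with inner-deg z z-inner
    ...   | inj₁ deg≡2 = no λ (_ , _ , leg , _) → 1+n≢n (trans (sym (leg-root-deg≡3 z-inner leg)) deg≡2)
    ...   | inj₂ (_ , Q , leg , unique-leg) with InLeg? z Q w
    ...     | yes w-leg = yes (Q , z-inner , leg , w-leg)
    ...     | no ¬w-leg = no λ (Q′ , _ , leg′ , w-leg′) →
                            ¬w-leg (subst (λ R → InLeg G z R w) (unique-leg Q′ leg′) w-leg′)

  VPplus? : ∀ w → Dec (VPplus G P u v w)
  VPplus? w with Inner? P u v w | any? (InLegOf? w) P
  ... | yes w-inner | _       = yes (inj₁ w-inner)
  ... | no _        | yes any = let z , Q , found = satisfied any in yes (inj₂ (z , Q , found))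
  ... | no ¬w-inner | no none = no λ where
    (inj₁ w-inner)                         → ¬w-inner w-inner
    (inj₂ (z , Q , z-inner , leg , w-leg)) → none (lose (proj₁ z-inner) (Q , z-inner , leg , w-leg))

lemma11 : ∀ {n} (G : Graph n) (u v : Fin n) (P : List (Fin n)) →
    u ≢ v →
    UniquePath G u v P →
    (∀ x → Inner G P u v x → deg G x ≡ 2 ⊎ (deg G x ≡ 3 × SingleLeg G x)) →
    (W L : Fin n → Set) →
    DetectionPair G W L →
    DetectionPair G
      (λ x → W x × ¬ VPplus G P u v x)
      (λ x → (L x × ¬ VPplus G P u v x) ⊎ (x ≡ u ⊎ x ≡ v))
lemma11 {n} G u v P _ P-unique inner-deg W L detect = distinguished
  where
  open Distance G
  open EndDistances G u v P P-unique inner-deg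

  L′ : Fin n → Set
  L′ x = (L x × ¬ VPplus G P u v x) ⊎ (x ≡ u ⊎ x ≡ v)

  separated-by-ends : ∀ x y → ¬ SameEndDists x y → ∃ λ l → L′ l × Separates G l x y
  separated-by-ends x y ¬same with ends-separate ¬same
  ... | inj₁ u-sep = u , inj₂ (inj₁ refl) , u-sep
  ... | inj₂ v-sep = v , inj₂ (inj₂ refl) , v-sep
  distinguished : DetectionPair G (λ x → W x × ¬ VPplus G P u v x) L′
  distinguished x with detect x
  ... | inj₁ (w , Ww , w-dom-x) with VPplus? w
  ...   | no w∉P⁺  = inj₁ (w , (Ww , w∉P⁺) , w-dom-x)
  ...   | yes w∈P⁺ = inj₂ λ y y≢x → inj₂ (separated-by-ends x y λ same →
                       y≢x (dominated-by-VPplus-determined w∈P⁺ w-dom-x (SameEndDists-sym same)))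
  distinguished x | inj₂ others = inj₂ λ y y≢x → case others y y≢x of λ where
    (inj₁ (w , Ww , w-dom-y)) → case VPplus? w of λ where
      (no w∉P⁺)  → inj₁ (w , (Ww , w∉P⁺) , w-dom-y)
      (yes w∈P⁺) → inj₂ (separated-by-ends x y λ same →
                     y≢x (sym (dominated-by-VPplus-determined w∈P⁺ w-dom-y same)))
    (inj₂ (l , Ll , l-sep)) → case VPplus? l of λ where
      (no l∉P⁺)  → inj₂ (l , inj₁ (Ll , l∉P⁺) , l-sep)
      (yes l∈P⁺) → inj₂ (separated-by-ends x y λ same →
                     l-sep (dist≡⇒SameDist (VPplus-same-dist (y≢x ∘ sym) same l∈P⁺)))
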